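{- There is an absolute constant $C$ such that the following holds. If $A = \{a_1 < a_2 < \dots\}$ is an admissible infinite strictly increasing sequence of natural numbers with $a_j \ge \exp(C j/\log j)$ for infinitely many $j$, then $A$ has property $Q$.
   Context: $\mathrm{SF}$ denotes the set of squarefree positive integers. A set $A \subseteq \mathbb{N}$ is admissible if for each prime $p$ there is a residue class $b_p \pmod{p^2}$ containing no element of $A$. $A$ has property $Q$ if there are infinitely many $n \in \mathbb{N}$ such that $n + a \in \mathrm{SF}$ for all $a \in A$ with $a < n$. -}

module Defs where

open import Data.Nat using (ℕ; suc; _+_; _*_; _^_; _≤_; _<_; ∣_-_∣)
open import Data.Nat.Divisibility using (_∣_)
open import Data.Nat.Primality using (Prime)
open import Data.Nat.Logarithm using (⌊log₂_⌋)
open import Data.Product using (Σ; _×_)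
open import Relation.Nullary using (¬_)

SquareFree : ℕ → Set
SquareFree m = (0 < m) × (∀ p → Prime p → ¬ (p * p ∣ m))

_≡_[mod_] : ℕ → ℕ → ℕ → Set
x ≡ y [mod m ] = m ∣ ∣ x - y ∣

-- A sequence a₁ < a₂ < … is represented by a : ℕ → ℕ with a j = a_{j+1}.
StrictlyIncreasing : (ℕ → ℕ) → Set
StrictlyIncreasing a = ∀ i → a i < a (suc i)

Admissible : (ℕ → ℕ) → Set
Admissible a = ∀ p → Prime p → Σ ℕ λ b → ∀ i → ¬ (a i ≡ b [mod p * p ])

PropertyQ : (ℕ → ℕ) → Set
PropertyQ a = ∀ N → Σ ℕ λ n → (N ≤ n) × (1 ≤ n) ×
  (∀ i → a i < n → SquareFree (n + a i))

-- "a_j ≥ exp(C j / log j) for infinitely many j", in the integer form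
-- a_j ^ ⌊log₂ j⌋ ≥ 2 ^ (C j)  (paper index j = i + 1)
GrowthCondition : ℕ → (ℕ → ℕ) → Set
GrowthCondition C a = ∀ N → Σ ℕ λ i → (N ≤ i) ×
  (2 ^ (C * suc i) ≤ a i ^ ⌊log₂ suc i ⌋)

{-# OPTIONS --safe #-}
module Submission where

-- Fix N and a j > N with a_j ^ ⌊log₂ (j+1)⌋ ≥ 2^(512 (j+1)), and let k be least with 8 j ≤ k 2^k,
-- so that y = 2^k is of order j / log j.  By admissibility and the Chinese remainder theorem there
-- is a residue r modulo M = (∏_{p ≤ y} p)² such that p² ∤ n + a_i for all n ≡ r (mod M), all i and
-- all primes p ≤ y.  Consider the T = 2^E candidates n_t = r + M (N + 1 + t), t < T.  For a prime
-- m > y, M is invertible modulo m², so the t with m² ∣ n_t + a_i are m² apart: a prime in the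
-- dyadic block (2^A, 2^(A+1)] spoils at most T / 4^A + 1 candidates for each i.  The block holds at
-- most 2^(A+1) / A primes, since their product divides the central binomial coefficient
-- (2^(A+1) choose 2^A) ≤ 4^(2^A).  Summing over i < j and over the blocks up to 2^(k+d), fewer than
-- T candidates are spoiled.  A surviving n is less than 2 M T, which the growth of a_j makes smaller
-- than a_j; so only a_0, …, a_(j-1) lie below n, and n + a_i < 2 n leaves no room for the square of
-- a prime beyond 2^(k+d).

open import Data.Bool.Base using (Bool; true; false; _∨_; if_then_else_)
open import Data.Bool.Properties using (∨-zeroʳ)
open import Data.Nat.Base
open import Data.Nat.Properties
open import Data.Nat.Induction using (<-rec)
open import Data.Nat.Logarithm using (⌊log₂_⌋; ⌊log₂⌋-mono-≤; ⌊log₂[2^n]⌋≡n; ⌊log₂⌊n/2⌋⌋≡⌊log₂n⌋∸1)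
open import Data.Nat.Tactic.RingSolver using (solve-∀)
open import Data.Nat.Divisibility
open import Data.Nat.Primality using (Prime; prime?; euclidsLemma; prime⇒nonTrivial; prime⇒irreducible)
open import Data.Nat.Coprimality using (Coprime; coprime-divisor; coprime-Bézout) renaming (sym to coprime-sym)
open import Data.Nat.GCD using (module Bézout)
open import Data.Nat.Combinatorics using (nCk+nC[k+1]≡[n+1]C[k+1]; k![n∸k]!∣n!; nCk≡n!/k![n-k]!) renaming (_C_ to _choose_)
open import Data.Nat.DivMod using (_%_; _/_; m/n*n≡m; m%n<n; m≡m%n+[m/n]*n)
open import Data.Product using (Σ; _×_; _,_; proj₁; proj₂)
open import Data.Sum using (_⊎_; inj₁; inj₂; map₂)
open import Function using (_∘_)
open import Relation.Nullary using (¬_; Dec; yes; no; does; contradiction)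
open import Relation.Nullary.Decidable using (dec-true; dec-false; _×-dec_)
open import Defs
open import Relation.Binary.PropositionalEquality

sumFrom : (ℕ → ℕ) → ℕ → ℕ → ℕ
sumFrom f s zero    = 0
sumFrom f s (suc l) = sumFrom f s l + f (s + l)

productFrom : (ℕ → ℕ) → ℕ → ℕ → ℕ
productFrom f s zero    = 1
productFrom f s (suc l) = productFrom f s l * f (s + l)

anyFrom : (ℕ → Bool) → ℕ → ℕ → Bool
anyFrom f s zero    = false
anyFrom f s (suc l) = anyFrom f s l ∨ f (s + l)

indicator : Bool → ℕ
indicator b = if b then 1 else 0

count : (ℕ → Bool) → ℕ → ℕ
count f zero    = 0
count f (suc t) = count f t + indicator (f t)

private
  <-+-suc : ∀ {x s l} → x < s + l → x < s + suc l
  <-+-suc {s = s} {l} x<s+l = ≤-trans x<s+l (≤-trans (n≤1+n _) (≤-reflexive (sym (+-suc s l))))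

  last<+-suc : ∀ s l → s + l < s + suc l
  last<+-suc s l = ≤-reflexive (sym (+-suc s l))

anyFrom-true : ∀ f s l {x} → s ≤ x → x < s + l → f x ≡ true → anyFrom f s l ≡ true
anyFrom-true f s zero    {x} s≤x x<s+0 _ = contradiction (≤-trans x<s+0 (≤-reflexive (+-identityʳ s))) (≤⇒≯ s≤x)
anyFrom-true f s (suc l) {x} s≤x x<s+l fx with x ≟ s + l
... | yes refl = trans (cong (anyFrom f s l ∨_) fx) (∨-zeroʳ _)
... | no x≢s+l = cong (_∨ f (s + l))
      (anyFrom-true f s l s≤x (≤∧≢⇒< (≤-pred (≤-trans x<s+l (≤-reflexive (+-suc s l)))) x≢s+l) fx)

sumFrom-mono-≤ : ∀ {f g} s l → (∀ x → s ≤ x → x < s + l → f x ≤ g x) → sumFrom f s l ≤ sumFrom g s l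
sumFrom-mono-≤ s zero    _  = z≤n
sumFrom-mono-≤ s (suc l) f≤g = +-mono-≤
  (sumFrom-mono-≤ s l λ x s≤x x<s+l → f≤g x s≤x (<-+-suc x<s+l))
  (f≤g (s + l) (m≤m+n s l) (last<+-suc s l))

*-distribˡ-sumFrom : ∀ c f s l → c * sumFrom f s l ≡ sumFrom (λ x → c * f x) s l
*-distribˡ-sumFrom c f s zero    = *-zeroʳ c
*-distribˡ-sumFrom c f s (suc l) = trans (*-distribˡ-+ c (sumFrom f s l) (f (s + l)))
  (cong (_+ c * f (s + l)) (*-distribˡ-sumFrom c f s l))

sumFrom-const : ∀ c s l → sumFrom (λ _ → c) s l ≡ l * c
sumFrom-const c s zero    = refl
sumFrom-const c s (suc l) = trans (cong (_+ c) (sumFrom-const c s l)) (+-comm (l * c) c)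

productFrom-+ : ∀ f s l l′ → productFrom f s (l + l′) ≡ productFrom f s l * productFrom f (s + l) l′
productFrom-+ f s l zero     = trans (cong (productFrom f s) (+-identityʳ l)) (sym (*-identityʳ _))
productFrom-+ f s l (suc l′) = begin
  productFrom f s (l + suc l′)                               ≡⟨ cong (productFrom f s) (+-suc l l′) ⟩
  productFrom f s (l + l′) * f (s + (l + l′))                ≡⟨ cong₂ _*_ (productFrom-+ f s l l′) (cong f (sym (+-assoc s l l′))) ⟩
  productFrom f s l * productFrom f (s + l) l′ * f (s + l + l′) ≡⟨ *-assoc (productFrom f s l) _ _ ⟩
  productFrom f s l * productFrom f (s + l) (suc l′)         ∎
  where open ≡-Reasoning

count-none : ∀ {f} → (∀ t → f t ≡ false) → ∀ T → count f T ≡ 0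
count-none f≡false zero    = refl
count-none f≡false (suc T) rewrite f≡false T = trans (+-identityʳ _) (count-none f≡false T)

count-∨ : ∀ f g T → count (λ t → f t ∨ g t) T ≤ count f T + count g T
count-∨ f g zero    = z≤n
count-∨ f g (suc T) = begin
  count (λ t → f t ∨ g t) T + indicator (f T ∨ g T)
    ≤⟨ +-mono-≤ (count-∨ f g T) (indicator-∨ (f T) (g T)) ⟩
  count f T + count g T + (indicator (f T) + indicator (g T))
    ≡⟨ interchange (count f T) (count g T) (indicator (f T)) (indicator (g T)) ⟩
  count f T + indicator (f T) + (count g T + indicator (g T)) ∎
  where
  open ≤-Reasoning
  indicator-∨ : ∀ b c → indicator (b ∨ c) ≤ indicator b + indicator c
  indicator-∨ true  c = s≤s z≤n
  indicator-∨ false c = ≤-refl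
  interchange : ∀ a b c d → a + b + (c + d) ≡ a + c + (b + d)
  interchange = solve-∀

count-anyFrom : ∀ (F : ℕ → ℕ → Bool) s l T →
  count (λ t → anyFrom (λ x → F x t) s l) T ≤ sumFrom (λ x → count (F x) T) s l
count-anyFrom F s zero    T = ≤-reflexive (count-none (λ _ → refl) T)
count-anyFrom F s (suc l) T = ≤-trans (count-∨ (λ t → anyFrom (λ x → F x t) s l) (F (s + l)) T)
  (+-monoˡ-≤ _ (count-anyFrom F s l T))

count<⇒∃false : ∀ f T → count f T < T → Σ ℕ λ t → t < T × f t ≡ false
count<⇒∃false f (suc T) c<T with f T in fT
... | false = T , ≤-refl , fT
... | true  with count<⇒∃false f T (≤-trans (≤-reflexive (+-comm 1 (count f T))) (≤-pred c<T))
...   | t , t<T , ft = t , m<n⇒m<1+n t<T , ft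

count-window : ∀ f s l → (∀ t → s ≤ t → t < s + l → f t ≡ false) → count f (s + l) ≡ count f s
count-window f s zero    _     = cong (count f) (+-identityʳ s)
count-window f s (suc l) quiet = begin
  count f (s + suc l)                     ≡⟨ cong (count f) (+-suc s l) ⟩
  count f (s + l) + indicator (f (s + l)) ≡⟨ cong (λ b → count f (s + l) + indicator b) (quiet (s + l) (m≤m+n s l) (last<+-suc s l)) ⟩
  count f (s + l) + 0                     ≡⟨ +-identityʳ _ ⟩
  count f (s + l)                         ≡⟨ count-window f s l (λ t s≤t t<s+l → quiet t s≤t (<-+-suc t<s+l)) ⟩
  count f s                               ∎
  where open ≡-Reasoning

Separated : ℕ → (ℕ → Bool) → Set
Separated d f = ∀ {t t′} → f t ≡ true → f t′ ≡ true → t < t′ → t + d ≤ t′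

separated-gap : ∀ d {f T} → Separated (suc d) f → f T ≡ true →
  ∀ s → T ≤ s + d → ∀ u → s ≤ u → u < T → f u ≡ false
separated-gap d {f} {T} sep fT s T≤s+d u s≤u u<T with f u in fu
... | false = refl
... | true  = contradiction s≤u (<⇒≱ (+-cancelʳ-≤ d (suc u) s (begin
      suc u + d   ≡⟨ +-suc u d ⟨
      u + suc d   ≤⟨ sep fu fT u<T ⟩
      T           ≤⟨ T≤s+d ⟩
      s + d       ∎)))
  where open ≤-Reasoning

count-separated : ∀ d {f} → Separated d f → ∀ T → d * count f T ≤ T + d
count-separated zero    _ T = z≤n
count-separated (suc d) {f} sep = <-rec _ go
  where
  D : ℕ
  D = suc d
  go : ∀ T → (∀ {s} → s < T → D * count f s ≤ s + D) → D * count f T ≤ T + D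
  go zero    _   = ≤-trans (≤-reflexive (*-zeroʳ D)) z≤n
  go (suc T) rec with f T in fT
  ... | false = begin
        D * (count f T + 0) ≡⟨ cong (D *_) (+-identityʳ _) ⟩
        D * count f T       ≤⟨ rec ≤-refl ⟩
        T + D               ≤⟨ +-monoˡ-≤ D (n≤1+n T) ⟩
        suc T + D           ∎
    where open ≤-Reasoning
  ... | true with d ≤? T
  ...   | no  T<d = begin
          D * (count f T + 1) ≡⟨ cong (λ c → D * (c + 1)) (count-window f 0 T (separated-gap d sep fT 0 (<⇒≤ (≰⇒> T<d)))) ⟩
          D * 1               ≡⟨ *-identityʳ D ⟩
          D                   ≤⟨ m≤n+m D (suc T) ⟩
          suc T + D           ∎
    where open ≤-Reasoning
  ...   | yes d≤T = begin
          D * (count f T + 1)       ≡⟨ cong (λ c → D * (c + 1)) (trans (cong (count f) (sym s+d≡T)) window) ⟩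
          D * (count f s + 1)       ≡⟨ *-distribˡ-+ D (count f s) 1 ⟩
          D * count f s + D * 1     ≤⟨ +-mono-≤ (rec (s≤s (m∸n≤m T d))) (≤-reflexive (*-identityʳ D)) ⟩
          s + D + D                 ≡⟨ cong (_+ D) (trans (+-suc s d) (cong suc s+d≡T)) ⟩
          suc T + D                 ∎
    where
    open ≤-Reasoning
    s : ℕ
    s = T ∸ d
    s+d≡T : s + d ≡ T
    s+d≡T = m∸n+n≡m d≤T
    window : count f (s + d) ≡ count f s
    window = count-window f s d λ u s≤u u<s+d →
      separated-gap d sep fT s (≤-reflexive (sym s+d≡T)) u s≤u (≤-trans u<s+d (≤-reflexive s+d≡T))

private
  doubling-step : ∀ x X y u c D → x * X + 2 * c * y ≤ 2 * c * x + D * y * x * x → x * u ≤ c + D * x * x →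
    (2 * x) * (X + y * u) + 2 * c * y ≤ 2 * c * (2 * x) + D * y * (2 * x) * (2 * x)
  doubling-step x X y u c D inv xu≤ = +-cancelʳ-≤ (2 * c * y) _ _ (begin
    (2 * x) * (X + y * u) + 2 * c * y + 2 * c * y       ≡⟨ split x X y u c ⟩
    2 * (x * X + 2 * c * y) + 2 * y * (x * u)            ≤⟨ +-mono-≤ (*-monoʳ-≤ 2 inv) (*-monoʳ-≤ (2 * y) xu≤) ⟩
    2 * (2 * c * x + D * y * x * x) + 2 * y * (c + D * x * x) ≡⟨ merge x y c D ⟩
    2 * c * (2 * x) + D * y * (2 * x) * (2 * x) + 2 * c * y ∎)
    where
    open ≤-Reasoning
    split : ∀ x X y u c → (2 * x) * (X + y * u) + 2 * c * y + 2 * c * y ≡ 2 * (x * X + 2 * c * y) + 2 * y * (x * u)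
    split = solve-∀
    merge : ∀ x y c D → 2 * (2 * c * x + D * y * x * x) + 2 * y * (c + D * x * x) ≡ 2 * c * (2 * x) + D * y * (2 * x) * (2 * x) + 2 * c * y
    merge = solve-∀

dyadic-sumFrom : ∀ (u : ℕ → ℕ) c D k → (∀ A → k ≤ A → 2 ^ A * u A ≤ c + D * 2 ^ A * 2 ^ A) →
  ∀ d → 2 ^ k * sumFrom u k d ≤ 2 * c + D * 2 ^ k * 2 ^ (k + d)
dyadic-sumFrom u c D k bound d = *-cancelˡ-≤ (2 ^ (k + d)) {{m^n≢0 2 (k + d)}} (+-cancelʳ-≤ (2 * c * y) _ _ (begin
    x * (y * sumFrom u k d) + 2 * c * y ≤⟨ invariant d ⟩
    2 * c * x + D * y * x * x           ≡⟨ factor x y c D ⟩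
    x * (2 * c + D * y * x)             ≤⟨ m≤m+n _ _ ⟩
    x * (2 * c + D * y * x) + 2 * c * y ∎))
  where
  open ≤-Reasoning
  y x : ℕ
  y = 2 ^ k
  x = 2 ^ (k + d)
  factor : ∀ x y c D → 2 * c * x + D * y * x * x ≡ x * (2 * c + D * y * x)
  factor = solve-∀
  -- multiplied through by 2 ^ (k + d), so that the geometric decay 2 ^ (k - A) needs no division
  invariant : ∀ d → 2 ^ (k + d) * (y * sumFrom u k d) + 2 * c * y ≤ 2 * c * 2 ^ (k + d) + D * y * 2 ^ (k + d) * 2 ^ (k + d)
  invariant zero    rewrite +-identityʳ k | *-zeroʳ y | *-zeroʳ y = m≤m+n _ _
  invariant (suc d) rewrite +-suc k d | *-distribˡ-+ y (sumFrom u k d) (u (k + d)) =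
    doubling-step (2 ^ (k + d)) (y * sumFrom u k d) y (u (k + d)) c D (invariant d) (bound (k + d) (m≤m+n k d))

2^m≤2^n⇒m≤n : ∀ m n → 2 ^ m ≤ 2 ^ n → m ≤ n
2^m≤2^n⇒m≤n m n 2^m≤2^n = subst₂ _≤_ (⌊log₂[2^n]⌋≡n m) (⌊log₂[2^n]⌋≡n n) (⌊log₂⌋-mono-≤ 2^m≤2^n)

n≤2^n : ∀ n → n ≤ 2 ^ n
n≤2^n zero    = z≤n
n≤2^n (suc n) = begin
  suc n            ≤⟨ s≤s (n≤2^n n) ⟩
  1 + 2 ^ n        ≤⟨ +-monoˡ-≤ (2 ^ n) (m^n>0 2 n) ⟩
  2 ^ n + 2 ^ n    ≡⟨ cong (2 ^ n +_) (+-identityʳ (2 ^ n)) ⟨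
  2 ^ suc n        ∎
  where open ≤-Reasoning

2^⌊log₂n⌋≤n : ∀ n → 1 ≤ n → 2 ^ ⌊log₂ n ⌋ ≤ n
2^⌊log₂n⌋≤n = <-rec _ go
  where
  go : ∀ n → (∀ {m} → m < n → 1 ≤ m → 2 ^ ⌊log₂ m ⌋ ≤ m) → 1 ≤ n → 2 ^ ⌊log₂ n ⌋ ≤ n
  go 1               _   _ = ≤-refl
  go n@(suc n₁@(suc _)) rec _ = halve ⌊log₂ n ⌋ refl
    where
    h : ℕ
    h = ⌊ n /2⌋
    halve : ∀ L → ⌊log₂ n ⌋ ≡ L → 2 ^ L ≤ n
    halve zero    _    = s≤s z≤n
    halve (suc L) logn≡1+L = begin
      2 * 2 ^ L             ≡⟨ cong (λ z → 2 * 2 ^ z) (trans (⌊log₂⌊n/2⌋⌋≡⌊log₂n⌋∸1 n) (cong (_∸ 1) logn≡1+L)) ⟨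
      2 * 2 ^ ⌊log₂ h ⌋     ≤⟨ *-monoʳ-≤ 2 (rec (⌊n/2⌋<n n₁) (s≤s z≤n)) ⟩
      h + (h + 0)           ≡⟨ cong (h +_) (+-identityʳ h) ⟩
      h + h                 ≤⟨ +-monoʳ-≤ h (⌊n/2⌋≤⌈n/2⌉ n) ⟩
      h + ⌈ n /2⌉           ≡⟨ ⌊n/2⌋+⌈n/2⌉≡n n ⟩
      n                     ∎
      where open ≤-Reasoning

m^o≤n^o⇒m≤n : ∀ m n o .{{_ : NonZero o}} → m ^ o ≤ n ^ o → m ≤ n
m^o≤n^o⇒m≤n m n o m^o≤n^o = ≮⇒≥ λ n<m → <⇒≱ (^-monoˡ-< o n<m) m^o≤n^o

minimal-k*2^k≥ : ∀ X → Σ ℕ λ k → X ≤ suc k * 2 ^ suc k × (k ≡ 0 ⊎ k * 2 ^ k < X)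
minimal-k*2^k≥ zero    = 0 , z≤n , inj₁ refl
minimal-k*2^k≥ (suc X) with minimal-k*2^k≥ X
... | k , X≤ , minimal with suc X ≤? suc k * 2 ^ suc k
...   | yes 1+X≤ = k , 1+X≤ , map₂ m<n⇒m<1+n minimal
...   | no  1+X≰ = suc k , ≤-trans (≤-reflexive (cong suc X≡)) (next (2 ^ suc k) (m^n>0 2 (suc k))) ,
                   inj₂ (≤-reflexive (cong suc (sym X≡)))
  where
  X≡ : X ≡ suc k * 2 ^ suc k
  X≡ = ≤-antisym X≤ (≤-pred (≰⇒> 1+X≰))
  next : ∀ w → 1 ≤ w → suc (suc k * w) ≤ suc (suc k) * (2 * w)
  next w w≥1 = begin
    suc (suc k * w)                         ≡⟨ +-comm 1 (suc k * w) ⟩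
    suc k * w + 1                           ≤⟨ +-monoʳ-≤ (suc k * w) w≥1 ⟩
    suc k * w + w                           ≤⟨ m≤m+n (suc k * w + w) (k * w + 2 * w) ⟩
    suc k * w + w + (k * w + 2 * w)         ≡⟨ expand k w ⟩
    suc (suc k) * (2 * w)                   ∎
    where
    open ≤-Reasoning
    expand : ∀ k w → suc k * w + w + (k * w + 2 * w) ≡ suc (suc k) * (2 * w)
    expand = solve-∀

dyadic-block : ∀ k d {p} → 2 ^ k < p → p ≤ 2 ^ (k + d) →
  Σ ℕ λ A → k ≤ A × A < k + d × 2 ^ A < p × p ≤ 2 ^ suc A
dyadic-block k zero    {p} 2^k<p p≤2^[k+0] =
  contradiction (≤-trans p≤2^[k+0] (≤-reflexive (cong (2 ^_) (+-identityʳ k)))) (<⇒≱ 2^k<p)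
dyadic-block k (suc d) {p} 2^k<p p≤2^[k+1+d] with p ≤? 2 ^ (k + d)
... | yes p≤2^[k+d] = let A , k≤A , A<k+d , lower , upper = dyadic-block k d 2^k<p p≤2^[k+d]
                      in A , k≤A , <-+-suc A<k+d , lower , upper
... | no  p≰2^[k+d] = k + d , m≤m+n k d , last<+-suc k d , ≰⇒> p≰2^[k+d] ,
                      ≤-trans p≤2^[k+1+d] (≤-reflexive (cong (2 ^_) (+-suc k d)))

prime⇒1<p : ∀ {p} → Prime p → 1 < p
prime⇒1<p {p} pp = nonTrivial⇒n>1 p {{prime⇒nonTrivial pp}}

prime∤1 : ∀ {p} → Prime p → ¬ p ∣ 1
prime∤1 pp p∣1 = <⇒≢ (prime⇒1<p pp) (sym (∣1⇒≡1 p∣1))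

¬∣⇒coprime : ∀ {p m} → Prime p → ¬ p ∣ m → Coprime p m
¬∣⇒coprime pp p∤m (i∣p , i∣m) with prime⇒irreducible pp i∣p
... | inj₁ i≡1 = i≡1
... | inj₂ refl = contradiction i∣m p∤m

coprime-*ˡ : ∀ {m n o} → Coprime m o → Coprime n o → Coprime (m * n) o
coprime-*ˡ {m} m⊥o n⊥o {i} (i∣mn , i∣o) = n⊥o (coprime-divisor i⊥m i∣mn , i∣o)
  where
  i⊥m : Coprime i m
  i⊥m (d∣i , d∣m) = m⊥o (d∣m , ∣-trans d∣i i∣o)

coprime-squares : ∀ {m n} → Coprime m n → Coprime (m * m) (n * n)
coprime-squares {m} {n} m⊥n = coprime-sym (coprime-*ˡ n⊥m² n⊥m²)
  where
  n⊥m² : Coprime n (m * m)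
  n⊥m² = coprime-sym (coprime-*ˡ m⊥n m⊥n)

prime∣∧∣∧∤⇒*∣ : ∀ {p m n} → Prime p → p ∣ n → m ∣ n → ¬ p ∣ m → m * p ∣ n
prime∣∧∣∧∤⇒*∣ {p} {m} pp (divides c refl) m∣cp p∤m =
  *-monoˡ-∣ p (coprime-divisor (coprime-sym (¬∣⇒coprime pp p∤m)) (subst (m ∣_) (*-comm c p) m∣cp))

∣⇒∣∣-∣ : ∀ {d m n} → d ∣ m → d ∣ n → d ∣ ∣ m - n ∣
∣⇒∣∣-∣ {d} (divides p refl) (divides q refl) = divides ∣ p - q ∣ (sym (*-distribʳ-∣-∣ d p q))

linearCongruence : ∀ m q r .{{_ : NonZero q}} → Coprime m q → Σ ℕ λ x → q ∣ r + m * x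
linearCongruence m (suc q) r m⊥q with coprime-Bézout m⊥q
... | Bézout.+- x y 1+yq≡xm = x * q * r , divides (r * (1 + y * q)) (begin
      r + m * (x * q * r)               ≡⟨ shuffle r m x q ⟩
      r + (x * m) * q * r               ≡⟨ cong (λ z → r + z * q * r) 1+yq≡xm ⟨
      r + (1 + y * suc q) * q * r       ≡⟨ factor r y q ⟩
      r * (1 + y * q) * suc q           ∎)
  where
  open ≡-Reasoning
  shuffle : ∀ r m x q → r + m * (x * q * r) ≡ r + (x * m) * q * r
  shuffle = solve-∀
  factor : ∀ r y q → r + (1 + y * suc q) * q * r ≡ r * (1 + y * q) * suc q
  factor = solve-∀
... | Bézout.-+ x y 1+xm≡yq = x * r , divides (r * y) (begin
      r + m * (x * r)    ≡⟨ factor r m x ⟩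
      r * (1 + x * m)    ≡⟨ cong (r *_) 1+xm≡yq ⟩
      r * (y * suc q)    ≡⟨ *-assoc r y (suc q) ⟨
      r * y * suc q      ∎)
  where
  open ≡-Reasoning
  factor : ∀ r m x → r + m * (x * r) ≡ r * (1 + x * m)
  factor = solve-∀

-- Primes, primorials and Chebyshev-type bounds

isPrime : ℕ → Bool
isPrime n = does (prime? n)

primeOrOne : ℕ → ℕ
primeOrOne n = if isPrime n then n else 1

primorial : ℕ → ℕ
primorial n = productFrom primeOrOne 1 n

primeCountFrom : ℕ → ℕ → ℕ
primeCountFrom = sumFrom (indicator ∘ isPrime)

primeOrOne-prime : ∀ {p} → Prime p → primeOrOne p ≡ p
primeOrOne-prime {p} pp = cong (if_then p else 1) (dec-true (prime? p) pp)

primeOrOne-nonprime : ∀ {n} → ¬ Prime n → primeOrOne n ≡ 1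
primeOrOne-nonprime {n} ¬pn = cong (if_then n else 1) (dec-false (prime? n) ¬pn)

productFrom-primeOrOne>0 : ∀ s l → 0 < productFrom primeOrOne s l
productFrom-primeOrOne>0 s zero    = s≤s z≤n
productFrom-primeOrOne>0 s (suc l) = *-mono-≤ (productFrom-primeOrOne>0 s l) (primeOrOne>0 (s + l))
  where
  primeOrOne>0 : ∀ n → 0 < primeOrOne n
  primeOrOne>0 n with prime? n
  ... | yes pn = <-trans (s≤s z≤n) (prime⇒1<p pn)
  ... | no  _  = s≤s z≤n

prime∤productFrom : ∀ {p} → Prime p → ∀ s l → s + l ≤ p → ¬ p ∣ productFrom primeOrOne s l
prime∤productFrom pp s zero    _   p∣1 = prime∤1 pp p∣1
prime∤productFrom {p} pp s (suc l) s+l<p p∣Π with euclidsLemma (productFrom primeOrOne s l) (primeOrOne (s + l)) pp p∣Π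
... | inj₁ p∣Π′ = prime∤productFrom pp s l (≤-trans (+-monoʳ-≤ s (n≤1+n l)) s+l<p) p∣Π′
... | inj₂ p∣q with prime? (s + l)
...   | no  _  = prime∤1 pp p∣q
...   | yes pq = <⇒≱ (≤-trans (≤-reflexive (sym (+-suc s l))) s+l<p)
                   (∣⇒≤ {{>-nonZero (<-trans (s≤s z≤n) (prime⇒1<p pq))}} p∣q)

prime∣primorial : ∀ {p} → Prime p → ∀ {n} → p ≤ n → p ∣ primorial n
prime∣primorial pp {zero} p≤0 = contradiction (≤-trans (prime⇒1<p pp) p≤0) λ ()
prime∣primorial {p} pp {suc n} p≤1+n with p ≟ suc n
... | no  p≢1+n = ∣m⇒∣m*n (primeOrOne (suc n)) (prime∣primorial pp (≤-pred (≤∧≢⇒< p≤1+n p≢1+n)))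
... | yes refl with prime? (suc n)
...   | yes _  = n∣m*n (primorial n)
...   | no  ¬p = contradiction pp ¬p

private
  prime∤! : ∀ {p} → Prime p → ∀ y → y < p → ¬ p ∣ y !
  prime∤! pp zero    _   p∣1 = prime∤1 pp p∣1
  prime∤! pp (suc y) y<p p∣y! with euclidsLemma (suc y) (y !) pp p∣y!
  ... | inj₁ p∣1+y = <⇒≱ y<p (∣⇒≤ p∣1+y)
  ... | inj₂ p∣y!  = prime∤! pp y (<-trans (n<1+n y) y<p) p∣y!

  ∣! : ∀ {p n} → 1 ≤ p → p ≤ n → p ∣ n !
  ∣! {suc p} _ p≤n = ∣-trans (m∣m*n (p !)) (m≤n⇒m!∣n! p≤n)

centralBinomial : ℕ → ℕ
centralBinomial y = (y + y) choose y

centralBinomial-* : ∀ y → centralBinomial y * (y ! * y !) ≡ (y + y) !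
centralBinomial-* y = begin
  centralBinomial y * (y ! * y !)             ≡⟨ cong (λ z → centralBinomial y * (y ! * z !)) (sym (m+n∸n≡m y y)) ⟩
  centralBinomial y * (y ! * (y + y ∸ y) !)   ≡⟨ cong (_* (y ! * (y + y ∸ y) !)) (nCk≡n!/k![n-k]! {y + y} {y} (m≤m+n y y)) ⟩
  _                                         ≡⟨ m/n*n≡m {{_}} (k![n∸k]!∣n! (m≤m+n y y)) ⟩
  (y + y) !                                 ∎
  where open ≡-Reasoning

centralBinomial≢0 : ∀ y → NonZero (centralBinomial y)
centralBinomial≢0 y = m*n≢0⇒m≢0 _ {{subst NonZero (sym (centralBinomial-* y)) ((y + y) !≢0)}}

prime∣centralBinomial : ∀ {p} → Prime p → ∀ y → y < p → p ≤ y + y → p ∣ centralBinomial y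
prime∣centralBinomial pp y y<p p≤2y
  with euclidsLemma (centralBinomial y) (y ! * y !) pp
         (subst (_ ∣_) (sym (centralBinomial-* y)) (∣! (<-trans (s≤s z≤n) (prime⇒1<p pp)) p≤2y))
... | inj₁ p∣C   = p∣C
... | inj₂ p∣y!² with euclidsLemma (y !) (y !) pp p∣y!²
...   | inj₁ p∣y! = contradiction p∣y! (prime∤! pp y y<p)
...   | inj₂ p∣y! = contradiction p∣y! (prime∤! pp y y<p)

choose≤2^ : ∀ n k → n choose k ≤ 2 ^ n
choose≤2^ zero    zero    = ≤-refl
choose≤2^ (suc n) zero    = m^n>0 2 (suc n)
choose≤2^ zero    (suc k) = z≤n
choose≤2^ (suc n) (suc k) = begin
  suc n choose suc k            ≡⟨ nCk+nC[k+1]≡[n+1]C[k+1] n k ⟨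
  n choose k + n choose suc k   ≤⟨ +-mono-≤ (choose≤2^ n k) (choose≤2^ n (suc k)) ⟩
  2 ^ n + 2 ^ n                 ≡⟨ cong (2 ^ n +_) (+-identityʳ (2 ^ n)) ⟨
  2 ^ suc n                     ∎
  where open ≤-Reasoning

productFrom-primeOrOne∣centralBinomial : ∀ y l → l ≤ y → productFrom primeOrOne (suc y) l ∣ centralBinomial y
productFrom-primeOrOne∣centralBinomial y zero    _   = 1∣ _
productFrom-primeOrOne∣centralBinomial y (suc l) l<y with prime? (suc y + l)
... | no  _  = subst (_∣ _) (sym (*-identityʳ _)) (productFrom-primeOrOne∣centralBinomial y l (<⇒≤ l<y))
... | yes pq = prime∣∧∣∧∤⇒*∣ pq
      (prime∣centralBinomial pq y (s≤s (m≤m+n y l)) (≤-trans (≤-reflexive (sym (+-suc y l))) (+-monoʳ-≤ y l<y)))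
      (productFrom-primeOrOne∣centralBinomial y l (<⇒≤ l<y))
      (prime∤productFrom pq (suc y) l ≤-refl)

productFrom-primeOrOne≤4^ : ∀ y → productFrom primeOrOne (suc y) y ≤ 2 ^ (y + y)
productFrom-primeOrOne≤4^ y = begin
  productFrom primeOrOne (suc y) y ≤⟨ ∣⇒≤ {{centralBinomial≢0 y}} (productFrom-primeOrOne∣centralBinomial y y ≤-refl) ⟩
  centralBinomial y                 ≤⟨ choose≤2^ (y + y) y ⟩
  2 ^ (y + y)                      ∎
  where open ≤-Reasoning

^primeCountFrom≤productFrom : ∀ y l → y ^ primeCountFrom (suc y) l ≤ productFrom primeOrOne (suc y) l
^primeCountFrom≤productFrom y zero    = ≤-refl
^primeCountFrom≤productFrom y (suc l) = begin
  y ^ (primeCountFrom (suc y) l + indicator (isPrime (suc y + l)))     ≡⟨ ^-distribˡ-+-* y (primeCountFrom (suc y) l) _ ⟩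
  y ^ primeCountFrom (suc y) l * y ^ indicator (isPrime (suc y + l))   ≤⟨ *-mono-≤ (^primeCountFrom≤productFrom y l) y^≤ ⟩
  productFrom primeOrOne (suc y) l * primeOrOne (suc y + l)           ∎
  where
  open ≤-Reasoning
  y^≤ : y ^ indicator (isPrime (suc y + l)) ≤ primeOrOne (suc y + l)
  y^≤ with prime? (suc y + l)
  ... | yes _ = ≤-trans (≤-reflexive (*-identityʳ y)) (≤-trans (n≤1+n y) (m≤m+n (suc y) l))
  ... | no  _ = ≤-refl

primeCountFrom-dyadic : ∀ A → A * primeCountFrom (suc (2 ^ A)) (2 ^ A) ≤ 2 ^ suc A
primeCountFrom-dyadic A = 2^m≤2^n⇒m≤n _ _ (begin
  2 ^ (A * c)                          ≡⟨ ^-*-assoc 2 A c ⟨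
  (2 ^ A) ^ c                          ≤⟨ ^primeCountFrom≤productFrom (2 ^ A) (2 ^ A) ⟩
  productFrom primeOrOne (suc (2 ^ A)) (2 ^ A) ≤⟨ productFrom-primeOrOne≤4^ (2 ^ A) ⟩
  2 ^ (2 ^ A + 2 ^ A)                  ≡⟨ cong (λ z → 2 ^ (2 ^ A + z)) (+-identityʳ (2 ^ A)) ⟨
  2 ^ (2 ^ suc A)                      ∎)
  where
  open ≤-Reasoning
  c : ℕ
  c = primeCountFrom (suc (2 ^ A)) (2 ^ A)

primorial-2^ : ∀ k → primorial (2 ^ k) ≤ 2 ^ (2 ^ suc k)
primorial-2^ zero    = s≤s z≤n
primorial-2^ (suc k) = begin
  primorial (2 ^ k + (2 ^ k + 0))           ≡⟨ cong (λ z → primorial (2 ^ k + z)) (+-identityʳ (2 ^ k)) ⟩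
  primorial (2 ^ k + 2 ^ k)                 ≡⟨ productFrom-+ primeOrOne 1 (2 ^ k) (2 ^ k) ⟩
  primorial (2 ^ k) * productFrom primeOrOne (suc (2 ^ k)) (2 ^ k)
                                            ≤⟨ *-mono-≤ (primorial-2^ k) (productFrom-primeOrOne≤4^ (2 ^ k)) ⟩
  2 ^ (2 ^ suc k) * 2 ^ (2 ^ k + 2 ^ k)     ≡⟨ cong (λ z → 2 ^ (2 ^ suc k) * 2 ^ (2 ^ k + z)) (+-identityʳ (2 ^ k)) ⟨
  2 ^ (2 ^ suc k) * 2 ^ (2 ^ suc k)         ≡⟨ ^-distribˡ-+-* 2 (2 ^ suc k) (2 ^ suc k) ⟨
  2 ^ (2 ^ suc k + 2 ^ suc k)               ≡⟨ cong (λ z → 2 ^ (2 ^ suc k + z)) (+-identityʳ (2 ^ suc k)) ⟨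
  2 ^ (2 ^ suc (suc k))                     ∎
  where open ≤-Reasoning

-- A residue class avoiding the squares of small primes

module Residues (a : ℕ → ℕ) where

  modulus : ℕ → ℕ
  modulus n = primorial n * primorial n

  AvoidsSquaresUpTo : ℕ → ℕ → Set
  AvoidsSquaresUpTo n r = ∀ {p} → Prime p → p ≤ n → ∀ s i → ¬ p * p ∣ r + modulus n * s + a i

  avoids-suc-nonprime : ∀ {n r} → ¬ Prime (suc n) → AvoidsSquaresUpTo n r → AvoidsSquaresUpTo (suc n) r
  avoids-suc-nonprime {n} {r} ¬p avoids {p} pp p≤1+n s i with p ≟ suc n
  ... | yes refl = contradiction pp ¬p
  ... | no  p≢  = λ p²∣ → avoids pp (≤-pred (≤∧≢⇒< p≤1+n p≢)) s i
                    (subst (λ P → p * p ∣ r + P * P * s + a i) primorial-suc p²∣)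
    where
    primorial-suc : primorial (suc n) ≡ primorial n
    primorial-suc = trans (cong (primorial n *_) (primeOrOne-nonprime ¬p)) (*-identityʳ _)

  avoids-suc-prime : Admissible a → ∀ {n r} → Prime (suc n) → AvoidsSquaresUpTo n r →
    Σ ℕ (AvoidsSquaresUpTo (suc n))
  avoids-suc-prime admissible {n} {r} pq avoids = r′ , avoids′
    where
    q M b : ℕ
    q = suc n
    M = modulus n
    b = proj₁ (admissible q pq)
    instance
      q²≢0 : NonZero (q * q)
      q²≢0 = _
    M⊥q² : Coprime M (q * q)
    M⊥q² = coprime-squares (coprime-sym (¬∣⇒coprime pq (prime∤productFrom pq 1 n ≤-refl)))
    x r′ : ℕ
    x = proj₁ (linearCongruence M (q * q) (r + b) M⊥q²)
    r′ = r + M * x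
    q²∣r′+b : q * q ∣ r′ + b
    q²∣r′+b = subst (q * q ∣_) (shuffle r b M x) (proj₂ (linearCongruence M (q * q) (r + b) M⊥q²))
      where
      shuffle : ∀ r b M x → r + b + M * x ≡ r + M * x + b
      shuffle = solve-∀
    class-suc : ∀ s i → r′ + modulus (suc n) * s + a i ≡ r′ + M * (q * q) * s + a i
    class-suc s i = trans (cong (λ P → r′ + P * P * s + a i) (cong (primorial n *_) (primeOrOne-prime pq)))
                          (cong (λ z → r′ + z * s + a i) ([m*n]*[o*p]≡[m*o]*[n*p] (primorial n) q (primorial n) q))
    avoids′ : AvoidsSquaresUpTo (suc n) r′
    avoids′ {p} pp p≤q s i p²∣ with p ≟ q
    ... | no  p≢q  = avoids pp (≤-pred (≤∧≢⇒< p≤q p≢q)) (x + q * q * s) i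
                       (subst (p * p ∣_) (trans (class-suc s i) (regroup r M x (q * q) s (a i))) p²∣)
      where
      regroup : ∀ r M x Q s aᵢ → r + M * x + M * Q * s + aᵢ ≡ r + M * (x + Q * s) + aᵢ
      regroup = solve-∀
    ... | yes refl = proj₂ (admissible q pq) i
                       (subst (q * q ∣_) (∣m+n-m+o∣≡∣n-o∣ r′ (a i) b) (∣⇒∣∣-∣ q²∣r′+aᵢ q²∣r′+b))
      where
      regroup : ∀ r′ M Q s aᵢ → r′ + M * Q * s + aᵢ ≡ M * s * Q + (r′ + aᵢ)
      regroup = solve-∀
      q²∣r′+aᵢ : q * q ∣ r′ + a i
      q²∣r′+aᵢ = ∣m+n∣m⇒∣n (subst (q * q ∣_) (trans (class-suc s i) (regroup r′ M (q * q) s (a i))) p²∣) (n∣m*n (M * s))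

  modulus≢0 : ∀ n → NonZero (modulus n)
  modulus≢0 n = >-nonZero (*-mono-≤ (productFrom-primeOrOne>0 1 n) (productFrom-primeOrOne>0 1 n))

  avoids-% : ∀ {n r} → AvoidsSquaresUpTo n r → AvoidsSquaresUpTo n ((r % modulus n) {{modulus≢0 n}})
  avoids-% {n} {r} avoids {p} pp p≤n s i p²∣ = avoids pp p≤n s i (subst (p * p ∣_) reassemble
      (∣m∣n⇒∣m+n p²∣ (∣m⇒∣m*n (r / M) (*-pres-∣ (prime∣primorial pp p≤n) (prime∣primorial pp p≤n)))))
    where
    instance
      M≢0 : NonZero (modulus n)
      M≢0 = modulus≢0 n
    M : ℕ
    M = modulus n
    reassemble : r % M + M * s + a i + M * (r / M) ≡ r + M * s + a i
    reassemble = trans (regroup (r % M) (r / M) M s (a i)) (cong (λ z → z + M * s + a i) (sym (m≡m%n+[m/n]*n r M)))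
      where
      regroup : ∀ x y M s aᵢ → x + M * s + aᵢ + M * y ≡ x + y * M + M * s + aᵢ
      regroup = solve-∀

  ∃avoids : Admissible a → ∀ n → Σ ℕ (AvoidsSquaresUpTo n)
  ∃avoids admissible zero = 0 , λ pp p≤0 → contradiction (≤-trans (prime⇒1<p pp) p≤0) λ ()
  ∃avoids admissible (suc n) = extend (prime? (suc n))
    where
    extend : Dec (Prime (suc n)) → Σ ℕ (AvoidsSquaresUpTo (suc n))
    extend (yes pq) = avoids-suc-prime admissible pq (proj₂ (∃avoids admissible n))
    extend (no  ¬p) = proj₁ (∃avoids admissible n) , avoids-suc-nonprime ¬p (proj₂ (∃avoids admissible n))

  ∃avoids< : Admissible a → ∀ n → Σ ℕ λ r → r < modulus n × AvoidsSquaresUpTo n r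
  ∃avoids< admissible n = r % modulus n , m%n<n r (modulus n) , avoids-% (proj₂ (∃avoids admissible n))
    where
    instance
      M≢0 : NonZero (modulus n)
      M≢0 = modulus≢0 n
    r : ℕ
    r = proj₁ (∃avoids admissible n)

-- Sieving the squares of large primes

does-true⇒ : ∀ {A : Set} (a? : Dec A) → does a? ≡ true → A
does-true⇒ (yes a) _ = a

module Sieve (a : ℕ → ℕ) (P base T : ℕ) where

  M : ℕ
  M = P * P

  shifted : ℕ → ℕ
  shifted t = base + M * t

  isHit : ℕ → ℕ → ℕ → Bool
  isHit i m t = does (prime? m ×-dec m * m ∣? shifted t + a i)

  isHit-intro : ∀ {i m t} → Prime m → m * m ∣ shifted t + a i → isHit i m t ≡ true
  isHit-intro {i} {m} {t} pm m²∣ = dec-true (prime? m ×-dec m * m ∣? shifted t + a i) (pm , m²∣)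

  isHit⇒ : ∀ {i m t} → isHit i m t ≡ true → Prime m × m * m ∣ shifted t + a i
  isHit⇒ {i} {m} {t} = does-true⇒ (prime? m ×-dec m * m ∣? shifted t + a i)

  hits-separated : ∀ i {m} → Prime m → ¬ m ∣ P → Separated (m * m) (isHit i m)
  hits-separated i {m} pm m∤P {t} {t′} hit hit′ t<t′ = begin
    t + m * m       ≤⟨ +-monoʳ-≤ t (∣⇒≤ {{>-nonZero (m<n⇒0<n∸m t<t′)}} m²∣gap) ⟩
    t + (t′ ∸ t)    ≡⟨ m+[n∸m]≡n (<⇒≤ t<t′) ⟩
    t′              ∎
    where
    open ≤-Reasoning
    gap : ℕ
    gap = t′ ∸ t
    shifted-t′ : shifted t′ + a i ≡ M * gap + (shifted t + a i)
    shifted-t′ = trans (cong (λ z → base + M * z + a i) (sym (m+[n∸m]≡n (<⇒≤ t<t′)))) (regroup base M t gap (a i))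
      where
      regroup : ∀ b M t g aᵢ → b + M * (t + g) + aᵢ ≡ M * g + (b + M * t + aᵢ)
      regroup = solve-∀
    m²∣M*gap : m * m ∣ M * gap
    m²∣M*gap = ∣m+n∣m⇒∣n (subst (m * m ∣_) (trans shifted-t′ (+-comm (M * gap) _)) (proj₂ (isHit⇒ {i} {m} hit′)))
                          (proj₂ (isHit⇒ {i} {m} hit))
    m²∣gap : m * m ∣ gap
    m²∣gap = coprime-divisor (coprime-squares (¬∣⇒coprime pm m∤P)) m²∣M*gap

  blockHits : ℕ → ℕ → ℕ
  blockHits i A = sumFrom (λ m → count (isHit i m) T) (suc (2 ^ A)) (2 ^ A)

  blockHits-bound : ∀ i A → (∀ {m} → Prime m → 2 ^ A < m → ¬ m ∣ P) →
    A * 2 ^ A * blockHits i A ≤ 2 * T + 8 * 2 ^ A * 2 ^ A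
  blockHits-bound i A large∤P = *-cancelˡ-≤ x {{m^n≢0 2 A}} (begin
      x * (A * x * S)          ≡⟨ regroup x A S ⟩
      A * (x * x * S)          ≤⟨ *-monoʳ-≤ A weighted ⟩
      A * (W * c)              ≡⟨ cong (A *_) (*-comm W c) ⟩
      A * (c * W)              ≡⟨ *-assoc A c W ⟨
      A * c * W                ≤⟨ *-monoˡ-≤ W (primeCountFrom-dyadic A) ⟩
      2 * x * W                ≡⟨ expand x T ⟩
      x * (2 * T + 8 * x * x)  ∎)
    where
    open ≤-Reasoning
    x S c W : ℕ
    x = 2 ^ A
    S = blockHits i A
    c = primeCountFrom (suc x) x
    W = T + 2 * x * (2 * x)
    regroup : ∀ x A S → x * (A * x * S) ≡ A * (x * x * S)
    regroup = solve-∀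
    expand : ∀ x T → 2 * x * (T + 2 * x * (2 * x)) ≡ x * (2 * T + 8 * x * x)
    expand = solve-∀
    perPrime : ∀ m → suc x ≤ m → m < suc x + x → x * x * count (isHit i m) T ≤ W * indicator (isPrime m)
    perPrime m x<m m≤2x = byPrimality (prime? m)
      where
      byPrimality : Dec (Prime m) → x * x * count (isHit i m) T ≤ W * indicator (isPrime m)
      byPrimality (no ¬pm) = ≤-trans (≤-reflexive (trans (cong (x * x *_) (count-none hit-false T)) (*-zeroʳ (x * x)))) z≤n
        where
        hit-false : ∀ t → isHit i m t ≡ false
        hit-false t = dec-false (prime? m ×-dec m * m ∣? shifted t + a i) (¬pm ∘ proj₁)
      byPrimality (yes pm) = begin
        x * x * count (isHit i m) T ≤⟨ *-monoˡ-≤ _ (*-mono-≤ (<⇒≤ x<m) (<⇒≤ x<m)) ⟩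
        m * m * count (isHit i m) T ≤⟨ count-separated (m * m) (hits-separated i pm (large∤P pm x<m)) T ⟩
        T + m * m                 ≤⟨ +-monoʳ-≤ T (*-mono-≤ m≤2x′ m≤2x′) ⟩
        W                         ≡⟨ *-identityʳ W ⟨
        W * 1                     ≡⟨ cong (λ b → W * indicator b) (dec-true (prime? m) pm) ⟨
        W * indicator (isPrime m) ∎
        where
        m≤2x′ : m ≤ 2 * x
        m≤2x′ = ≤-trans (≤-pred m≤2x) (≤-reflexive (cong (x +_) (sym (+-identityʳ x))))
    weighted : x * x * S ≤ W * c
    weighted = begin
      x * x * S                                             ≡⟨ *-distribˡ-sumFrom (x * x) _ (suc x) x ⟩
      sumFrom (λ m → x * x * count (isHit i m) T) (suc x) x   ≤⟨ sumFrom-mono-≤ (suc x) x perPrime ⟩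
      sumFrom (λ m → W * indicator (isPrime m)) (suc x) x   ≡⟨ *-distribˡ-sumFrom W _ (suc x) x ⟨
      W * c                                                 ∎

  isBad : ℕ → ℕ → ℕ → ℕ → Bool
  isBad j k d t = anyFrom (λ i → anyFrom (λ A → anyFrom (λ m → isHit i m t) (suc (2 ^ A)) (2 ^ A)) k d) 0 j

  isBad-intro : ∀ {j k d t i A p} → i < j → k ≤ A → A < k + d → 2 ^ A < p → p ≤ 2 ^ suc A →
    Prime p → p * p ∣ shifted t + a i → isBad j k d t ≡ true
  isBad-intro {j} {k} {d} {t} {i} {A} {p} i<j k≤A A<k+d 2^A<p p≤2^[1+A] pp p²∣ =
    anyFrom-true (λ i → anyFrom (λ A → anyFrom (λ m → isHit i m t) (suc (2 ^ A)) (2 ^ A)) k d) 0 j z≤n i<j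
      (anyFrom-true (λ A → anyFrom (λ m → isHit i m t) (suc (2 ^ A)) (2 ^ A)) k d k≤A A<k+d
        (anyFrom-true (λ m → isHit i m t) (suc (2 ^ A)) (2 ^ A) 2^A<p p<1+2^A+2^A (isHit-intro pp p²∣)))
    where
    p<1+2^A+2^A : p < suc (2 ^ A) + 2 ^ A
    p<1+2^A+2^A = s≤s (≤-trans p≤2^[1+A] (≤-reflexive (cong (2 ^ A +_) (+-identityʳ (2 ^ A)))))

  count-isBad : ∀ j k d → (∀ {m} → Prime m → 2 ^ k < m → ¬ m ∣ P) →
    2 ^ k * (k * count (isBad j k d) T) ≤ j * (4 * T + 8 * 2 ^ k * 2 ^ (k + d))
  count-isBad j k d large∤P = begin
    2 ^ k * (k * count (isBad j k d) T)                      ≤⟨ *-monoʳ-≤ (2 ^ k) (*-monoʳ-≤ k count-isBad≤) ⟩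
    2 ^ k * (k * sumFrom V 0 j)                            ≡⟨ cong (2 ^ k *_) (*-distribˡ-sumFrom k V 0 j) ⟩
    2 ^ k * sumFrom (λ i → k * V i) 0 j                    ≡⟨ *-distribˡ-sumFrom (2 ^ k) _ 0 j ⟩
    sumFrom (λ i → 2 ^ k * (k * V i)) 0 j                  ≤⟨ sumFrom-mono-≤ 0 j (λ i _ _ → perShift i) ⟩
    sumFrom (λ _ → 4 * T + 8 * 2 ^ k * 2 ^ (k + d)) 0 j    ≡⟨ sumFrom-const _ 0 j ⟩
    j * (4 * T + 8 * 2 ^ k * 2 ^ (k + d))                  ∎
    where
    open ≤-Reasoning
    V : ℕ → ℕ
    V i = sumFrom (blockHits i) k d
    count-isBad≤ : count (isBad j k d) T ≤ sumFrom V 0 j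
    count-isBad≤ = ≤-trans (count-anyFrom _ 0 j T) (sumFrom-mono-≤ 0 j λ i _ _ →
      ≤-trans (count-anyFrom _ k d T) (sumFrom-mono-≤ k d λ A _ _ → count-anyFrom _ (suc (2 ^ A)) (2 ^ A) T))
    perShift : ∀ i → 2 ^ k * (k * V i) ≤ 4 * T + 8 * 2 ^ k * 2 ^ (k + d)
    perShift i = begin
      2 ^ k * (k * V i)                          ≡⟨ cong (2 ^ k *_) (*-distribˡ-sumFrom k (blockHits i) k d) ⟩
      2 ^ k * sumFrom (λ A → k * blockHits i A) k d ≤⟨ dyadic-sumFrom _ (2 * T) 8 k perBlock d ⟩
      2 * (2 * T) + 8 * 2 ^ k * 2 ^ (k + d)      ≡⟨ cong (_+ 8 * 2 ^ k * 2 ^ (k + d)) (*-assoc 2 2 T) ⟨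
      4 * T + 8 * 2 ^ k * 2 ^ (k + d)            ∎
      where
      perBlock : ∀ A → k ≤ A → 2 ^ A * (k * blockHits i A) ≤ 2 * T + 8 * 2 ^ A * 2 ^ A
      perBlock A k≤A = begin
        2 ^ A * (k * blockHits i A) ≡⟨ swap (2 ^ A) k (blockHits i A) ⟩
        k * 2 ^ A * blockHits i A   ≤⟨ *-monoˡ-≤ (blockHits i A) (*-monoˡ-≤ (2 ^ A) k≤A) ⟩
        A * 2 ^ A * blockHits i A   ≤⟨ blockHits-bound i A (λ pm 2^A<m → large∤P pm (≤-trans (s≤s (^-monoʳ-≤ 2 k≤A)) 2^A<m)) ⟩
        2 * T + 8 * 2 ^ A * 2 ^ A   ∎
        where
        swap : ∀ x k S → x * (k * S) ≡ k * x * S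
        swap = solve-∀

count-slack : ∀ {k y j T x c} → 1 ≤ k → 0 < y → 0 < T → 8 * j ≤ k * y → 32 * j * x ≤ T →
  y * (k * c) ≤ j * (4 * T + 8 * y * x) → c < T
count-slack {k} {y} {j} {T} {x} {c} k≥1 y>0 T>0 8j≤ky 32jx≤T yk·c≤ =
  *-cancelˡ-< 4 c T (*-cancelˡ-< (k * y) (4 * c) (4 * T) (begin-strict
    k * y * (4 * c)                     ≡⟨ lhs k y c ⟩
    4 * (y * (k * c))                   ≤⟨ *-monoʳ-≤ 4 yk·c≤ ⟩
    4 * (j * (4 * T + 8 * y * x))       ≡⟨ rhs j T y x ⟩
    2 * T * (8 * j) + y * (32 * j * x)  ≤⟨ +-mono-≤ (*-monoʳ-≤ (2 * T) 8j≤ky) (*-monoʳ-≤ y 32jx≤T) ⟩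
    2 * T * (k * y) + y * T             ≤⟨ +-monoʳ-≤ (2 * T * (k * y)) (*-monoʳ-≤ y (m≤n*m T k {{>-nonZero k≥1}})) ⟩
    2 * T * (k * y) + y * (k * T)       <⟨ +-monoʳ-< (2 * T * (k * y)) (≤-trans (≤-reflexive (cong suc (swap k y T))) (m<m+n _ kyT>0)) ⟩
    2 * T * (k * y) + (k * y * T + k * y * T) ≡⟨ total k y T ⟩
    k * y * (4 * T)                     ∎))
  where
  open ≤-Reasoning
  kyT>0 : 0 < k * y * T
  kyT>0 = *-mono-≤ (*-mono-≤ k≥1 y>0) T>0
  lhs : ∀ k y c → k * y * (4 * c) ≡ 4 * (y * (k * c))
  lhs = solve-∀
  rhs : ∀ j T y x → 4 * (j * (4 * T + 8 * y * x)) ≡ 2 * T * (8 * j) + y * (32 * j * x)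
  rhs = solve-∀
  swap : ∀ k y T → y * (k * T) ≡ k * y * T
  swap = solve-∀
  total : ∀ k y T → 2 * T * (k * y) + (k * y * T + k * y * T) ≡ k * y * (4 * T)
  total = solve-∀

module SquarefreeShift (a : ℕ → ℕ) (admissible : Admissible a) (j N k d E : ℕ) (k≥1 : 1 ≤ k)
  (8j≤k2^k : 8 * j ≤ k * 2 ^ k) (32j2^[k+d]≤2^E : 32 * j * 2 ^ (k + d) ≤ 2 ^ E)
  (exponents : 4 * 2 ^ k + E + 2 ≤ 2 * (k + d)) (N<j : N < j) where

  open Residues a

  y T r : ℕ
  y = 2 ^ k
  T = 2 ^ E
  r = proj₁ (∃avoids< admissible y)

  open Sieve a (primorial y) (r + modulus y * suc N) T

  large∤primorial : ∀ {m} → Prime m → y < m → ¬ m ∣ primorial y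
  large∤primorial pm y<m = prime∤productFrom pm 1 y y<m

  good-shift : Σ ℕ λ t → t < T × isBad j k d t ≡ false
  good-shift = count<⇒∃false (isBad j k d) T
    (count-slack {j = j} {x = 2 ^ (k + d)} k≥1 (m^n>0 2 k) (m^n>0 2 E) 8j≤k2^k 32j2^[k+d]≤2^E (count-isBad j k d large∤primorial))

  D : ℕ
  D = 4 * y + E + 1

  N<shifted : ∀ t → N < shifted t
  N<shifted t = begin-strict
    N                 <⟨ n<1+n N ⟩
    suc N             ≤⟨ m≤n*m (suc N) M {{modulus≢0 y}} ⟩
    M * suc N         ≤⟨ m≤n+m (M * suc N) r ⟩
    r + M * suc N     ≤⟨ m≤m+n (r + M * suc N) (M * t) ⟩
    shifted t         ∎
    where open ≤-Reasoning

  shifted<2^D : ∀ {t} → t < T → shifted t < 2 ^ D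
  shifted<2^D {t} t<T = begin-strict
    r + M * suc N + M * t               <⟨ +-monoˡ-< (M * t) (+-monoˡ-< (M * suc N) (proj₁ (proj₂ (∃avoids< admissible y)))) ⟩
    M + M * suc N + M * t               ≡⟨ factor M N t ⟩
    M * (suc N + suc t)                 ≤⟨ *-monoʳ-≤ M (+-mono-≤ 1+N≤T t<T) ⟩
    M * (T + T)                         ≤⟨ *-monoˡ-≤ (T + T) (*-mono-≤ (primorial-2^ k) (primorial-2^ k)) ⟩
    2 ^ (2 * y) * 2 ^ (2 * y) * (T + T) ≡⟨ cong₂ _*_ (^-distribˡ-+-* 2 (2 * y) (2 * y)) (cong (T +_) (+-identityʳ T)) ⟨
    2 ^ (2 * y + 2 * y) * 2 ^ suc E     ≡⟨ ^-distribˡ-+-* 2 (2 * y + 2 * y) (suc E) ⟨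
    2 ^ (2 * y + 2 * y + suc E)         ≡⟨ cong (2 ^_) (regroup y E) ⟩
    2 ^ D                               ∎
    where
    open ≤-Reasoning
    factor : ∀ M N t → M + M * suc N + M * t ≡ M * (suc N + suc t)
    factor = solve-∀
    regroup : ∀ y E → 2 * y + 2 * y + suc E ≡ 4 * y + E + 1
    regroup = solve-∀
    1+N≤T : suc N ≤ T
    1+N≤T = ≤-trans N<j (≤-trans (m≤n*m j 32) (≤-trans (m≤m*n (32 * j) (2 ^ (k + d)) {{m^n≢0 2 (k + d)}}) 32j2^[k+d]≤2^E))

  p²∣shifted⇒p≤2^[k+d] : ∀ {t i p} → t < T → a i < shifted t → p * p ∣ shifted t + a i → p ≤ 2 ^ (k + d)
  p²∣shifted⇒p≤2^[k+d] {t} {i} {p} t<T aᵢ<n p²∣ = ≮⇒≥ λ 2^[k+d]<p → <⇒≱ (begin-strict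
    p * p                      ≤⟨ ∣⇒≤ {{>-nonZero (≤-trans (≤-trans (s≤s z≤n) (N<shifted t)) (m≤m+n _ (a i)))}} p²∣ ⟩
    shifted t + a i            <⟨ +-mono-< (shifted<2^D t<T) (<-trans aᵢ<n (shifted<2^D t<T)) ⟩
    2 ^ D + 2 ^ D              ≡⟨ cong (2 ^ D +_) (+-identityʳ (2 ^ D)) ⟨
    2 ^ suc D                  ≤⟨ ^-monoʳ-≤ 2 1+D≤2[k+d] ⟩
    2 ^ ((k + d) + (k + d))    ≡⟨ ^-distribˡ-+-* 2 (k + d) (k + d) ⟩
    2 ^ (k + d) * 2 ^ (k + d)  ∎) (<⇒≤ (*-mono-< 2^[k+d]<p 2^[k+d]<p))
    where
    open ≤-Reasoning
    1+D≤2[k+d] : suc D ≤ (k + d) + (k + d)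
    1+D≤2[k+d] = ≤-trans (≤-reflexive (regroup y E)) (≤-trans exponents (≤-reflexive (cong (k + d +_) (+-identityʳ (k + d)))))
      where
      regroup : ∀ y E → suc (4 * y + E + 1) ≡ 4 * y + E + 2
      regroup = solve-∀

  good⇒squarefree : ∀ {t} → t < T → isBad j k d t ≡ false → ∀ i → i < j → a i < shifted t → SquareFree (shifted t + a i)
  good⇒squarefree {t} t<T good i i<j aᵢ<n = ≤-trans (≤-trans (s≤s z≤n) (N<shifted t)) (m≤m+n _ (a i)) , notSquare
    where
    notSquare : ∀ p → Prime p → ¬ p * p ∣ shifted t + a i
    notSquare p pp p²∣ with p ≤? y
    ... | yes p≤y = proj₂ (proj₂ (∃avoids< admissible y)) pp p≤y (suc N + t) i
                      (subst (p * p ∣_) (regroup r (modulus y) N t (a i)) p²∣)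
      where
      regroup : ∀ r M N t aᵢ → r + M * suc N + M * t + aᵢ ≡ r + M * (suc N + t) + aᵢ
      regroup = solve-∀
    ... | no  p≰y = contradiction (trans (sym bad) good) λ ()
      where
      bad : isBad j k d t ≡ true
      bad = let A , k≤A , A<k+d , 2^A<p , p≤2^[1+A] = dyadic-block k d (≰⇒> p≰y) (p²∣shifted⇒p≤2^[k+d] t<T aᵢ<n p²∣) in
        isBad-intro i<j k≤A A<k+d 2^A<p p≤2^[1+A] pp p²∣

  ∃squarefree-shift : Σ ℕ λ n → N < n × n < 2 ^ D × (∀ i → i < j → a i < n → SquareFree (n + a i))
  ∃squarefree-shift = let t , t<T , t-good = good-shift in
    shifted t , N<shifted t , shifted<2^D t<T , good⇒squarefree t<T t-good

-- k = k′ + 1 is the least k with 8 j ≤ k 2^k (see minimal-k*2^k≥), so 2^k is of order j / log j;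
-- the primes up to 2^(k+d) are sieved over 2^E shifts.
module Parameters (j k′ : ℕ) (8j≤ky : 8 * j ≤ suc k′ * 2 ^ suc k′) (minimal : k′ ≡ 0 ⊎ k′ * 2 ^ k′ < 8 * j) where

  k y e E d L : ℕ
  k  = suc k′
  y  = 2 ^ k
  e  = 2 * y + 3 * k + 8
  E  = e + e
  d  = 2 * y + e + 1
  L  = ⌊log₂ suc j ⌋

  ky≤y² : k * y ≤ y * y
  ky≤y² = *-monoˡ-≤ y (n≤2^n k)

  j≤y² : j ≤ y * y
  j≤y² = ≤-trans (m≤n*m j 8) (≤-trans 8j≤ky ky≤y²)

  32j2^[k+d]≤2^E : 32 * j * 2 ^ (k + d) ≤ 2 ^ E
  32j2^[k+d]≤2^E = begin
    32 * j * 2 ^ (k + d)                 ≤⟨ *-monoˡ-≤ (2 ^ (k + d)) (*-monoʳ-≤ 32 j≤y²) ⟩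
    2 ^ 5 * (y * y) * 2 ^ (k + d)        ≡⟨ cong (λ z → 2 ^ 5 * z * 2 ^ (k + d)) (^-distribˡ-+-* 2 k k) ⟨
    2 ^ 5 * 2 ^ (k + k) * 2 ^ (k + d)    ≡⟨ cong (_* 2 ^ (k + d)) (^-distribˡ-+-* 2 5 (k + k)) ⟨
    2 ^ (5 + (k + k)) * 2 ^ (k + d)      ≡⟨ ^-distribˡ-+-* 2 (5 + (k + k)) (k + d) ⟨
    2 ^ (5 + (k + k) + (k + d))          ≤⟨ ^-monoʳ-≤ 2 (≤-trans (m≤m+n (5 + (k + k) + (k + d)) 2) (≤-reflexive (regroup y k))) ⟩
    2 ^ E                                ∎
    where
    open ≤-Reasoning
    regroup : ∀ y k → 5 + (k + k) + (k + (2 * y + (2 * y + 3 * k + 8) + 1)) + 2 ≡ (2 * y + 3 * k + 8) + (2 * y + 3 * k + 8)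
    regroup = solve-∀

  exponents : 4 * y + E + 2 ≤ 2 * (k + d)
  exponents = ≤-trans (m≤m+n _ (2 * k)) (≤-reflexive (regroup y k))
    where
    regroup : ∀ y k → 4 * y + ((2 * y + 3 * k + 8) + (2 * y + 3 * k + 8)) + 2 + 2 * k ≡ 2 * (k + (2 * y + (2 * y + 3 * k + 8) + 1))
    regroup = solve-∀

  module _ (j≥1 : 1 ≤ j) where

    1≤L : 1 ≤ L
    1≤L = ⌊log₂⌋-mono-≤ (s≤s j≥1)

    2^L≤1+j : 2 ^ L ≤ suc j
    2^L≤1+j = 2^⌊log₂n⌋≤n (suc j) (s≤s z≤n)

    L≤2k′ : L ≤ k′ + k′
    L≤2k′ = ≤-pred (≤-pred (≤-trans (≤-reflexive (+-comm 2 L)) (≤-trans (2^m≤2^n⇒m≤n (L + 2) (k + k) (begin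
      2 ^ (L + 2)     ≡⟨ ^-distribˡ-+-* 2 L 2 ⟩
      2 ^ L * 4       ≤⟨ *-monoˡ-≤ 4 2^L≤1+j ⟩
      suc j * 4       ≤⟨ ≤-trans (≤-reflexive (regroup j)) (+-monoʳ-≤ (4 * j) (*-monoʳ-≤ 4 j≥1)) ⟩
      4 * j + 4 * j   ≡⟨ double j ⟩
      8 * j           ≤⟨ 8j≤ky ⟩
      k * y           ≤⟨ ky≤y² ⟩
      y * y           ≡⟨ ^-distribˡ-+-* 2 k k ⟨
      2 ^ (k + k)     ∎)) (≤-reflexive (cong suc (+-suc k′ k′))))))
      where
      open ≤-Reasoning
      regroup : ∀ j → suc j * 4 ≡ 4 * j + 4 * 1
      regroup = solve-∀
      double : ∀ j → 4 * j + 4 * j ≡ 8 * j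
      double = solve-∀

    yL≤32j : y * L ≤ 32 * j
    yL≤32j = byMinimality minimal
      where
      byMinimality : k′ ≡ 0 ⊎ k′ * 2 ^ k′ < 8 * j → y * L ≤ 32 * j
      byMinimality (inj₁ k′≡0) = ≤-trans (*-monoʳ-≤ y L≤0) (≤-trans (≤-reflexive (*-zeroʳ y)) z≤n)
        where
        L≤0 : L ≤ 0
        L≤0 = ≤-trans L≤2k′ (≤-reflexive (cong (λ z → z + z) k′≡0))
      byMinimality (inj₂ k′2^k′<8j) = begin
        y * L                     ≤⟨ *-monoʳ-≤ y L≤2k′ ⟩
        2 * 2 ^ k′ * (k′ + k′)    ≡⟨ regroup (2 ^ k′) k′ ⟩
        4 * (k′ * 2 ^ k′)         ≤⟨ *-monoʳ-≤ 4 (<⇒≤ k′2^k′<8j) ⟩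
        4 * (8 * j)               ≡⟨ *-assoc 4 8 j ⟨
        32 * j                    ∎
        where
        open ≤-Reasoning
        regroup : ∀ w k′ → 2 * w * (k′ + k′) ≡ 4 * (k′ * w)
        regroup = solve-∀

    exponent-bound : (4 * y + E + 1) * L ≤ 512 * suc j
    exponent-bound = begin
      (4 * y + E + 1) * L                      ≡⟨ expand y k L ⟩
      8 * (y * L) + 6 * (k * L) + 17 * L
        ≤⟨ +-mono-≤ (+-mono-≤ (*-monoʳ-≤ 8 yL≤32j) (*-monoʳ-≤ 6 kL≤32j)) (*-monoʳ-≤ 17 L≤1+j) ⟩
      8 * (32 * j) + 6 * (32 * j) + 17 * suc j ≤⟨ m≤m+n _ (47 * j + 495) ⟩
      8 * (32 * j) + 6 * (32 * j) + 17 * suc j + (47 * j + 495) ≡⟨ total j ⟩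
      512 * suc j                              ∎
      where
      open ≤-Reasoning
      kL≤32j : k * L ≤ 32 * j
      kL≤32j = ≤-trans (*-monoˡ-≤ L (n≤2^n k)) yL≤32j
      L≤1+j : L ≤ suc j
      L≤1+j = ≤-trans (n≤2^n L) 2^L≤1+j
      expand : ∀ y k L → (4 * y + ((2 * y + 3 * k + 8) + (2 * y + 3 * k + 8)) + 1) * L ≡ 8 * (y * L) + 6 * (k * L) + 17 * L
      expand = solve-∀
      total : ∀ j → 8 * (32 * j) + 6 * (32 * j) + 17 * suc j + (47 * j + 495) ≡ 512 * suc j
      total = solve-∀

    2^D≤ : ∀ {x} → 2 ^ (512 * suc j) ≤ x ^ L → 2 ^ (4 * y + E + 1) ≤ x
    2^D≤ {x} large = m^o≤n^o⇒m≤n _ x L {{>-nonZero 1≤L}} (begin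
      (2 ^ (4 * y + E + 1)) ^ L   ≡⟨ ^-*-assoc 2 (4 * y + E + 1) L ⟩
      2 ^ ((4 * y + E + 1) * L)   ≤⟨ ^-monoʳ-≤ 2 exponent-bound ⟩
      2 ^ (512 * suc j)           ≤⟨ large ⟩
      x ^ L                       ∎)
      where open ≤-Reasoning

large-term⇒squarefree-shift : ∀ {a} → Admissible a → ∀ {N j} → N < j → 2 ^ (512 * suc j) ≤ a j ^ ⌊log₂ suc j ⌋ →
  Σ ℕ λ n → N < n × n < a j × (∀ i → i < j → a i < n → SquareFree (n + a i))
large-term⇒squarefree-shift {a} admissible {N} {j} N<j aⱼ-large =
  let n , N<n , n<2^D , squarefree = SquarefreeShift.∃squarefree-shift a admissible j N k d E
                                       (s≤s z≤n) 8j≤k2^k 32j2^[k+d]≤2^E exponents N<j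
  in n , N<n , <-≤-trans n<2^D (2^D≤ (≤-trans (s≤s z≤n) N<j) aⱼ-large) , squarefree
  where
  k-spec : Σ ℕ λ k → 8 * j ≤ suc k * 2 ^ suc k × (k ≡ 0 ⊎ k * 2 ^ k < 8 * j)
  k-spec = minimal-k*2^k≥ (8 * j)
  8j≤k2^k : 8 * j ≤ suc (proj₁ k-spec) * 2 ^ suc (proj₁ k-spec)
  8j≤k2^k = proj₁ (proj₂ k-spec)
  open Parameters j (proj₁ k-spec) 8j≤k2^k (proj₂ (proj₂ k-spec))

increasing⇒monotone : ∀ {a} → StrictlyIncreasing a → ∀ {i j} → i ≤ j → a i ≤ a j
increasing⇒monotone {a} increasing = monotone′ ∘ ≤⇒≤′
  where
  monotone′ : ∀ {i j} → i ≤′ j → a i ≤ a j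
  monotone′ ≤′-refl        = ≤-refl
  monotone′ (≤′-step i≤′j) = ≤-trans (monotone′ i≤′j) (<⇒≤ (increasing _))

increasing-<⁻¹ : ∀ {a} → StrictlyIncreasing a → ∀ {i j} → a i < a j → i < j
increasing-<⁻¹ increasing aᵢ<aⱼ = ≰⇒> λ j≤i → <⇒≱ aᵢ<aⱼ (increasing⇒monotone increasing j≤i)

theorem1p5 : Σ ℕ λ C → (a : ℕ → ℕ) → (∀ i → 1 ≤ a i) → StrictlyIncreasing a →
    Admissible a → GrowthCondition C a → PropertyQ a
theorem1p5 = 512 , λ a _ increasing admissible growth N →
  let j , N<j , aⱼ-large = growth (suc N)
      n , N<n , n<aⱼ , squarefree = large-term⇒squarefree-shift admissible N<j aⱼ-large
      index< : ∀ {i} → a i < n → i < j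
      index< aᵢ<n = increasing-<⁻¹ increasing (<-trans aᵢ<n n<aⱼ)
  in n , <⇒≤ N<n , ≤-trans (s≤s z≤n) N<n , λ i aᵢ<n → squarefree i (index< aᵢ<n) aᵢ<n
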